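{- Let $\langle L,G,H,F,P\rangle$ be a tense ICRDL-algebra. Then for all $x\in L$: (1) $G(\neg x)\le\neg G(x)$ and $H(\neg x)\le\neg H(x)$; (2) $G(\neg x)\le\neg F(x)$ and $H(\neg x)\le\neg P(x)$; (3) $G(x)\le\neg F(\neg x)$ and $H(x)\le\neg P(\neg x)$; (4) $F(\neg x)\le\neg G(x)$ and $P(\neg x)\le\neg H(x)$.
   Context: An ICRDL-algebra is a structure $\langle L,\vee,\wedge,\cdot,\to,0,1\rangle$ such that $\langle L,\vee,\wedge,0,1\rangle$ is a bounded distributive lattice, $\langle L,\cdot,1\rangle$ is a commutative monoid, and $x\cdot y\le z$ iff $x\le y\to z$; $\neg x:=x\to 0$. A tense ICRDL-algebra is an ICRDL-algebra with unary operations $G,H,F,P$ satisfying: (T1) $P(x)\le y$ iff $x\le G(y)$; (T2) $F(x)\le y$ iff $x\le H(y)$; (T3) $G(0)=0$, $H(0)=0$; (T4) $G(x)\cdot F(y)\le F(x\cdot y)$ and $H(x)\cdot P(y)\le P(x\cdot y)$; (T5) $G(x\vee y)\le G(x)\vee F(y)$ and $H(x\vee y)\le H(x)\vee P(y)$; (T6) $G(x\to y)\le G(x)\to G(y)$ and $H(x\to y)\le H(x)\to H(y)$. -}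

module Defs where

open import Level using (Level; suc; _⊔_)
open import Relation.Binary.PropositionalEquality using (_≡_)
open import Function.Bundles using (_⇔_)

record ICRDL (ℓ : Level) : Set (suc ℓ) where
  infixr 6 _∨_
  infixr 7 _∧_
  infixr 8 _·_
  infixr 5 _⇒_
  infix 4 _≤_
  field
    Carrier : Set ℓ
    _∨_ _∧_ _·_ _⇒_ : Carrier → Carrier → Carrier
    𝟘 𝟙 : Carrier
    ∨-comm : ∀ x y → x ∨ y ≡ y ∨ x
    ∧-comm : ∀ x y → x ∧ y ≡ y ∧ x
    ∨-assoc : ∀ x y z → (x ∨ y) ∨ z ≡ x ∨ (y ∨ z)
    ∧-assoc : ∀ x y z → (x ∧ y) ∧ z ≡ x ∧ (y ∧ z)
    ∨-absorbs-∧ : ∀ x y → x ∨ (x ∧ y) ≡ x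
    ∧-absorbs-∨ : ∀ x y → x ∧ (x ∨ y) ≡ x
    ∧-distribˡ-∨ : ∀ x y z → x ∧ (y ∨ z) ≡ (x ∧ y) ∨ (x ∧ z)
    ∨-identityʳ : ∀ x → x ∨ 𝟘 ≡ x
    ∧-identityʳ : ∀ x → x ∧ 𝟙 ≡ x
    ·-comm : ∀ x y → x · y ≡ y · x
    ·-assoc : ∀ x y z → (x · y) · z ≡ x · (y · z)
    ·-identityʳ : ∀ x → x · 𝟙 ≡ x

  _≤_ : Carrier → Carrier → Set ℓ
  x ≤ y = x ∧ y ≡ x

  field
    residuation : ∀ x y z → (x · y ≤ z) ⇔ (x ≤ (y ⇒ z))

  ¬_ : Carrier → Carrier
  ¬ x = x ⇒ 𝟘

record TenseICRDL (ℓ : Level) : Set (suc ℓ) where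
  field
    icrdl : ICRDL ℓ
  open ICRDL icrdl public
  field
    G H F P : Carrier → Carrier
    T1 : ∀ x y → (P x ≤ y) ⇔ (x ≤ G y)
    T2 : ∀ x y → (F x ≤ y) ⇔ (x ≤ H y)
    T3-G : G 𝟘 ≡ 𝟘
    T3-H : H 𝟘 ≡ 𝟘
    T4-G : ∀ x y → G x · F y ≤ F (x · y)
    T4-H : ∀ x y → H x · P y ≤ P (x · y)
    T5-G : ∀ x y → G (x ∨ y) ≤ G x ∨ F y
    T5-H : ∀ x y → H (x ∨ y) ≤ H x ∨ P y
    T6-G : ∀ x y → G (x ⇒ y) ≤ (G x ⇒ G y)
    T6-H : ∀ x y → H (x ⇒ y) ≤ (H x ⇒ H y)

{-# OPTIONS --safe #-}
module Submission where

-- (1) is T6 at y = 0 together with T3.  For (2)–(4) only two facts about the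
-- pair (Q, K) = (G, F) resp. (H, P) are used: K is a left adjoint (by T2 resp.
-- T1), hence monotone with K 0 = 0, and Q x · K y ≤ K (x · y) (T4).  Then
-- x · y ≤ 0 implies Q x · K y ≤ K (x · y) ≤ K 0 = 0; applied to ¬ x · x ≤ 0
-- and x · ¬ x ≤ 0, residuation turns this into the inequalities.

open import Defs
open import Data.Product using (_×_; _,_)
open import Relation.Binary.PropositionalEquality using (_≡_; refl; sym; trans; cong; subst)
open import Function.Bundles using (_⇔_; Equivalence)

open Equivalence using (to; from)

module ICRDLProperties {ℓ} (L : ICRDL ℓ) where
  open ICRDL L

  ≤-refl : ∀ x → x ≤ x
  ≤-refl x = trans (cong (x ∧_) (sym (∨-absorbs-∧ x x))) (∧-absorbs-∨ x (x ∧ x))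

  ≤-reflexive : ∀ {x y} → x ≡ y → x ≤ y
  ≤-reflexive {x} refl = ≤-refl x

  ≤-trans : ∀ {x y z} → x ≤ y → y ≤ z → x ≤ z
  ≤-trans {x} {y} {z} x≤y y≤z =
    trans (cong (_∧ z) (sym x≤y)) (trans (∧-assoc x y z) (trans (cong (x ∧_) y≤z) x≤y))

  𝟘-minimum : ∀ x → 𝟘 ≤ x
  𝟘-minimum x =
    trans (cong (𝟘 ∧_) (sym (trans (∨-comm 𝟘 x) (∨-identityʳ x)))) (∧-absorbs-∨ 𝟘 x)

  ¬-cancel : ∀ x → ¬ x · x ≤ 𝟘
  ¬-cancel x = from (residuation (¬ x) x 𝟘) (≤-refl (¬ x))

  ¬-cancelʳ : ∀ x → x · ¬ x ≤ 𝟘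
  ¬-cancelʳ x = ≤-trans (≤-reflexive (·-comm x (¬ x))) (¬-cancel x)

  ·≤𝟘⇒≤¬ : ∀ {x y} → x · y ≤ 𝟘 → x ≤ ¬ y
  ·≤𝟘⇒≤¬ {x} {y} = to (residuation x y 𝟘)

  ·≤𝟘⇒≤¬ʳ : ∀ {x y} → x · y ≤ 𝟘 → y ≤ ¬ x
  ·≤𝟘⇒≤¬ʳ {x} {y} xy≤𝟘 = ·≤𝟘⇒≤¬ (≤-trans (≤-reflexive (·-comm y x)) xy≤𝟘)

  module LeftAdjoint (K R : Carrier → Carrier) (K⊣R : ∀ x y → (K x ≤ y) ⇔ (x ≤ R y)) where

    mono : ∀ {x y} → x ≤ y → K x ≤ K y
    mono {x} {y} x≤y = from (K⊣R x (K y)) (≤-trans x≤y (to (K⊣R y (K y)) (≤-refl (K y))))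

    K𝟘≤𝟘 : K 𝟘 ≤ 𝟘
    K𝟘≤𝟘 = from (K⊣R 𝟘 𝟘) (𝟘-minimum (R 𝟘))

    module Strong (Q : Carrier → Carrier) (strength : ∀ x y → Q x · K y ≤ K (x · y)) where

      annihilate : ∀ {x y} → x · y ≤ 𝟘 → Q x · K y ≤ 𝟘
      annihilate {x} {y} xy≤𝟘 = ≤-trans (strength x y) (≤-trans (mono xy≤𝟘) K𝟘≤𝟘)

      Q¬≤¬K : ∀ x → Q (¬ x) ≤ ¬ K x
      Q¬≤¬K x = ·≤𝟘⇒≤¬ (annihilate (¬-cancel x))

      Q≤¬K¬ : ∀ x → Q x ≤ ¬ K (¬ x)
      Q≤¬K¬ x = ·≤𝟘⇒≤¬ (annihilate (¬-cancelʳ x))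

      K¬≤¬Q : ∀ x → K (¬ x) ≤ ¬ Q x
      K¬≤¬Q x = ·≤𝟘⇒≤¬ʳ (annihilate (¬-cancelʳ x))

  Q¬≤¬Q : (Q : Carrier → Carrier) → Q 𝟘 ≡ 𝟘 → (∀ x y → Q (x ⇒ y) ≤ (Q x ⇒ Q y)) →
          ∀ x → Q (¬ x) ≤ ¬ Q x
  Q¬≤¬Q Q Q𝟘≡𝟘 Q-⇒ x = subst (λ z → Q (¬ x) ≤ (Q x ⇒ z)) Q𝟘≡𝟘 (Q-⇒ x 𝟘)

mainTheorem5 : ∀ {ℓ} (A : TenseICRDL ℓ) → let open TenseICRDL A in ∀ x →
      ((G (¬ x) ≤ ¬ G x) × (H (¬ x) ≤ ¬ H x))
    × ((G (¬ x) ≤ ¬ F x) × (H (¬ x) ≤ ¬ P x))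
    × ((G x ≤ ¬ F (¬ x)) × (H x ≤ ¬ P (¬ x)))
    × ((F (¬ x) ≤ ¬ G x) × (P (¬ x) ≤ ¬ H x))
mainTheorem5 A x =
    (Q¬≤¬Q G T3-G T6-G x , Q¬≤¬Q H T3-H T6-H x)
  , (GF.Q¬≤¬K x , HP.Q¬≤¬K x)
  , (GF.Q≤¬K¬ x , HP.Q≤¬K¬ x)
  , (GF.K¬≤¬Q x , HP.K¬≤¬Q x)
  where
    open TenseICRDL A
    open ICRDLProperties icrdl
    module GF = LeftAdjoint.Strong F H T2 G T4-G
    module HP = LeftAdjoint.Strong P G T1 H T4-H
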